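{- Let $k\ge1$, $n=2k-1$, and $0\le i<3^n$ with $m(i)=k$. Then $C_n(i)=1$.
   Context: The unit weight-$3$ Stern–Brocot sequences $SB_n$ ($n\ge0$): $SB_0=(\frac{0}{1},\frac{1}{1})$, and $SB_{n+1}$ is obtained from $SB_n$ by keeping all its terms in order and inserting, between each pair of consecutive terms $\frac{p}{q},\frac{r}{s}$ (in lowest terms, positive denominators), the two fractions $\frac{2p+r}{2q+s}$ and $\frac{p+2r}{q+2s}$, each reduced to lowest terms, in this order. $SB_n$ has $3^n+1$ terms, indexed from $0$. For $0\le i<3^n$, $C_n(i)=qr-ps$ where $\frac{p}{q}$ and $\frac{r}{s}$ are the $i$-th and $(i+1)$-th terms of $SB_n$ in lowest terms with positive denominators. Middleness: write $i$ in base $3$ with exactly $n$ digits $d_1d_2\cdots d_n$ (leading zeros allowed, $d_1$ most significant); $m(i)$ is the least $t\ge1$ with $d_t\in\{0,2\}$. -}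

module Defs where

open import Data.Nat using (ℕ; zero; suc; _+_; _*_; _∸_; _^_; _≤_; _<_)
open import Data.Nat.DivMod using (_/_; _%_)
open import Data.Nat.GCD using (gcd)
open import Data.Integer as ℤ using (ℤ; +_)
open import Data.List using (List; []; _∷_)
open import Data.Product using (_×_; _,_)
open import Data.Sum using (_⊎_)
open import Relation.Binary.PropositionalEquality using (_≡_)

-- A fraction p/q is represented by the pair (p , q).
Frac : Set
Frac = ℕ × ℕ

reduce : ℕ → ℕ → Frac
reduce p q with gcd p q
... | zero  = p , q
... | suc g = p / suc g , q / suc g

left right : Frac → Frac → Frac
left  (p , q) (r , s) = reduce (2 * p + r) (2 * q + s)
right (p , q) (r , s) = reduce (p + 2 * r) (q + 2 * s)

step : List Frac → List Frac
step [] = []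
step (x ∷ []) = x ∷ []
step (x ∷ y ∷ rest) = x ∷ left x y ∷ right x y ∷ step (y ∷ rest)

SB : ℕ → List Frac
SB zero    = (0 , 1) ∷ (1 , 1) ∷ []
SB (suc n) = step (SB n)

-- i-th element of a list (0-indexed), with a default (0 , 1) out of range
-- (never used in the theorem since i + 1 ≤ 3^n < length (SB n)).
nth : List Frac → ℕ → Frac
nth [] _ = 0 , 1
nth (x ∷ xs) zero = x
nth (x ∷ xs) (suc i) = nth xs i

det : Frac → Frac → ℤ
det (p , q) (r , s) = (+ q) ℤ.* (+ r) ℤ.- (+ p) ℤ.* (+ s)

C : ℕ → ℕ → ℤ
C n i = det (nth (SB n) i) (nth (SB n) (suc i))

-- t-th base-3 digit (t = 1 most significant) of i written with exactly n digits.
-- div3pow e i = ⌊ i / 3^e ⌋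
div3pow : ℕ → ℕ → ℕ
div3pow zero    i = i
div3pow (suc e) i = div3pow e i / 3

digit : ℕ → ℕ → ℕ → ℕ
digit n i t = div3pow (n ∸ t) i % 3

-- Middleness: m(i) = k, i.e. k is the least t ≥ 1 with d_t ∈ {0,2}.
Middleness : ℕ → ℕ → ℕ → Set
Middleness n i k =
  (1 ≤ k) × (k ≤ n) × (digit n i k ≡ 0 ⊎ digit n i k ≡ 2)
  × (∀ t → 1 ≤ t → t < k → digit n i t ≡ 1)

-- Write the consecutive pairs of SB_n as a ternary tree: the pair at index i is reached from
-- ((0/1), (1/1)) by the children selected by the digits d_1 … d_n of i.  Call a pair
-- (p/q, r/s) m-adjacent if q = m q', s = m s', q' r − p s' = 1 and p ≡ r (mod m).  If the
-- pair is 3m-adjacent, then 3 divides both unreduced numerators 2p + r and p + 2r, the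
-- reduction divides out exactly that 3, and all three children are m-adjacent.  The k − 1
-- leading digits 1 keep us on the central pair (a/3^(k−1), (a+1)/3^(k−1)), 2a + 1 = 3^(k−1);
-- the digit d_k ∈ {0, 2} then leaves a 3^(k−1)-adjacent pair, and the remaining k − 1 digits
-- bring it down to a 1-adjacent pair, whose determinant is 1.
module Submission where

open import Defs
open import Data.Nat using (ℕ; zero; suc; _+_; _*_; _∸_; _^_; _≤_; _<_; s≤s; z≤n)
open import Data.Nat.Properties
open import Data.Nat.Divisibility
open import Data.Nat.DivMod using (_/_; _%_; m*n/n≡m; n/1≡n; m≡m%n+[m/n]*n; m%n<n; m<n*o⇒m/o<n)
open import Data.Nat.GCD using (gcd; c*gcd[m,n]≡gcd[cm,cn])
open import Data.Nat.Coprimality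
  using (Coprime; coprime⇒gcd≡1; coprime-divisor) renaming (sym to coprime-sym)
open import Data.Nat.Tactic.RingSolver using (solve; solve-∀)
open import Data.Integer as ℤ using (+_)
open import Data.Integer.Properties using (pos-*; [+m]-[+n]≡m⊖n; ⊖-≥)
open import Data.List using (List; []; _∷_; length)
open import Data.Product using (_×_; _,_; proj₁; proj₂)
open import Data.Sum using (_⊎_; inj₁; inj₂)
open import Relation.Binary.PropositionalEquality
open ≡-Reasoning

∣n+1∣n⇒≡1 : ∀ {d n} → d ∣ n + 1 → d ∣ n → d ≡ 1
∣n+1∣n⇒≡1 d∣n+1 d∣n = ∣1⇒≡1 (∣m+n∣m⇒∣n d∣n+1 d∣n)

unit-det⇒coprime : ∀ a c {b d} → a * b ≡ c * d + 1 → Coprime b d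
unit-det⇒coprime a c eq {e} (e∣b , e∣d) =
  ∣n+1∣n⇒≡1 (subst (e ∣_) eq (∣n⇒∣m*n a e∣b)) (∣n⇒∣m*n c e∣d)

coprime-* : ∀ {a m n} → Coprime a m → Coprime a n → Coprime a (m * n)
coprime-* {a} {m} a⊥m a⊥n {d} (d∣a , d∣mn) = a⊥n (d∣a , coprime-divisor d⊥m d∣mn)
  where
  d⊥m : Coprime d m
  d⊥m (e∣d , e∣m) = a⊥m (∣-trans e∣d d∣a , e∣m)

reduce-gcd : ∀ p q g → gcd p q ≡ suc g → reduce p q ≡ (p / suc g , q / suc g)
reduce-gcd p q g eq with gcd p q
... | suc h with eq
...   | refl = refl

reduce-coprime : ∀ {p q} → Coprime p q → reduce p q ≡ (p , q)
reduce-coprime {p} {q} p⊥q =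
  trans (reduce-gcd p q 0 (coprime⇒gcd≡1 p⊥q)) (cong₂ _,_ (n/1≡n p) (n/1≡n q))

reduce-scaled : ∀ c {p q} → Coprime p q → reduce (suc c * p) (suc c * q) ≡ (p , q)
reduce-scaled c {p} {q} p⊥q =
  trans (reduce-gcd (suc c * p) (suc c * q) c gcd≡) (cong₂ _,_ (cancel p) (cancel q))
  where
  gcd≡ : gcd (suc c * p) (suc c * q) ≡ suc c
  gcd≡ = begin
    gcd (suc c * p) (suc c * q) ≡⟨ c*gcd[m,n]≡gcd[cm,cn] (suc c) p q ⟨
    suc c * gcd p q             ≡⟨ cong (suc c *_) (coprime⇒gcd≡1 p⊥q) ⟩
    suc c * 1                   ≡⟨ *-identityʳ (suc c) ⟩
    suc c                       ∎
  cancel : ∀ x → suc c * x / suc c ≡ x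
  cancel x = trans (cong (_/ suc c) (*-comm (suc c) x)) (m*n/n≡m x (suc c))

infix 4 _≡_mod_

data _≡_mod_ (a b m : ℕ) : Set where
  below : ∀ t → b ≡ a + m * t → a ≡ b mod m
  above : ∀ t → a ≡ b + m * t → a ≡ b mod m

∣-resp-mod : ∀ {a b m d} → a ≡ b mod m → d ∣ m → d ∣ a → d ∣ b
∣-resp-mod {m = m} (below t refl) d∣m d∣a = ∣m∣n⇒∣m+n d∣a (∣m⇒∣m*n t d∣m)
∣-resp-mod {b = b} {m} {d} (above t refl) d∣m d∣a =
  ∣m+n∣m⇒∣n (subst (d ∣_) (+-comm b (m * t)) d∣a) (∣m⇒∣m*n t d∣m)

mod-sym : ∀ {a b m} → a ≡ b mod m → b ≡ a mod m
mod-sym (below t eq) = above t eq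
mod-sym (above t eq) = below t eq

coprime-resp-mod : ∀ {a b m} → a ≡ b mod m → Coprime a m → Coprime b m
coprime-resp-mod a≡b a⊥m (d∣b , d∣m) = a⊥m (∣-resp-mod (mod-sym a≡b) d∣m d∣b , d∣m)

record Trisection (m p r : ℕ) : Set where
  constructor trisection
  field
    w v     : ℕ
    2p+r≡3w : 2 * p + r ≡ 3 * w
    p+2r≡3v : p + 2 * r ≡ 3 * v
    p≡w     : p ≡ w mod m
    w≡v     : w ≡ v mod m
    v≡r     : v ≡ r mod m

trisect : ∀ {m p r} → p ≡ r mod 3 * m → Trisection m p r
trisect {m} {p} (below t refl) =
  trisection (p + m * t) (p + m * t + m * t)
    (solve (p ∷ m ∷ t ∷ [])) (solve (p ∷ m ∷ t ∷ []))
    (below t refl) (below t refl) (below t (solve (p ∷ m ∷ t ∷ [])))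
trisect {m} {r = r} (above t refl) =
  trisection (r + m * t + m * t) (r + m * t)
    (solve (r ∷ m ∷ t ∷ [])) (solve (r ∷ m ∷ t ∷ []))
    (above t (solve (r ∷ m ∷ t ∷ []))) (above t refl) (above t refl)

data Adjacent (m : ℕ) : Frac × Frac → Set where
  adjacent : ∀ {p q r s} q′ s′ → q ≡ m * q′ → s ≡ m * s′ → q′ * r ≡ p * s′ + 1 →
             p ≡ r mod m → Adjacent m ((p , q) , (r , s))

adjacent⇒coprime : ∀ {m p q r s} → Adjacent m ((p , q) , (r , s)) → Coprime p m
adjacent⇒coprime {p = p} (adjacent q′ s′ _ _ det≡ p≡r) {d} (d∣p , d∣m) =
  ∣n+1∣n⇒≡1 (subst (d ∣_) det≡ (∣n⇒∣m*n q′ (∣-resp-mod p≡r d∣m d∣p)))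
    (∣m⇒∣m*n s′ d∣p)

det-adjacent : ∀ {x y} → Adjacent 1 (x , y) → det x y ≡ + 1
det-adjacent {p , _} {r , _} (adjacent q′ s′ refl refl det≡ _) = begin
  + (1 * q′) ℤ.* + r ℤ.- + p ℤ.* + (1 * s′)
    ≡⟨ cong₂ (λ a b → + a ℤ.* + r ℤ.- + p ℤ.* + b) (*-identityˡ q′) (*-identityˡ s′) ⟩
  + q′ ℤ.* + r ℤ.- + p ℤ.* + s′
    ≡⟨ cong₂ ℤ._-_ (pos-* q′ r) (pos-* p s′) ⟨
  + (q′ * r) ℤ.- + (p * s′)  ≡⟨ [+m]-[+n]≡m⊖n (q′ * r) (p * s′) ⟩
  q′ * r ℤ.⊖ p * s′          ≡⟨ cong (ℤ._⊖ p * s′) det≡ ⟩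
  p * s′ + 1 ℤ.⊖ p * s′      ≡⟨ ⊖-≥ (m≤m+n (p * s′) 1) ⟩
  + (p * s′ + 1 ∸ p * s′)    ≡⟨ cong +_ (m+n∸m≡n (p * s′) 1) ⟩
  + 1                        ∎

module ChildDeterminants {p q′ r s′ : ℕ} (det≡ : q′ * r ≡ p * s′ + 1) where

  det-left : ∀ w → 2 * p + r ≡ 3 * w → 3 * q′ * w ≡ p * (2 * q′ + s′) + 1
  det-left w 2p+r≡3w = begin
    3 * q′ * w                  ≡⟨ solve (q′ ∷ w ∷ []) ⟩
    q′ * (3 * w)                ≡⟨ cong (q′ *_) 2p+r≡3w ⟨
    q′ * (2 * p + r)            ≡⟨ solve (p ∷ q′ ∷ r ∷ []) ⟩
    2 * (p * q′) + q′ * r       ≡⟨ cong (λ x → 2 * (p * q′) + x) det≡ ⟩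
    2 * (p * q′) + (p * s′ + 1) ≡⟨ solve (p ∷ q′ ∷ s′ ∷ []) ⟩
    p * (2 * q′ + s′) + 1       ∎

  det-right : ∀ v → p + 2 * r ≡ 3 * v → (q′ + 2 * s′) * r ≡ v * (3 * s′) + 1
  det-right v p+2r≡3v = begin
    (q′ + 2 * s′) * r         ≡⟨ solve (q′ ∷ s′ ∷ r ∷ []) ⟩
    q′ * r + 2 * (s′ * r)     ≡⟨ cong (_+ 2 * (s′ * r)) det≡ ⟩
    p * s′ + 1 + 2 * (s′ * r) ≡⟨ solve (p ∷ s′ ∷ r ∷ []) ⟩
    (p + 2 * r) * s′ + 1      ≡⟨ cong (λ x → x * s′ + 1) p+2r≡3v ⟩
    3 * v * s′ + 1            ≡⟨ solve (v ∷ s′ ∷ []) ⟩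
    v * (3 * s′) + 1          ∎

  det-middle : ∀ w v → 2 * p + r ≡ 3 * w → p + 2 * r ≡ 3 * v →
               (2 * q′ + s′) * v ≡ w * (q′ + 2 * s′) + 1
  det-middle w v 2p+r≡3w p+2r≡3v = *-cancelˡ-≡ _ _ 3 (begin
    3 * ((2 * q′ + s′) * v)        ≡⟨ solve (q′ ∷ s′ ∷ v ∷ []) ⟩
    (2 * q′ + s′) * (3 * v)        ≡⟨ cong ((2 * q′ + s′) *_) p+2r≡3v ⟨
    (2 * q′ + s′) * (p + 2 * r)    ≡⟨ solve (q′ ∷ s′ ∷ p ∷ r ∷ []) ⟩
    2 * (q′ * p) + s′ * p + 2 * (s′ * r) + q′ * r + 3 * (q′ * r)
      ≡⟨ cong (λ x → 2 * (q′ * p) + s′ * p + 2 * (s′ * r) + q′ * r + 3 * x) det≡ ⟩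
    2 * (q′ * p) + s′ * p + 2 * (s′ * r) + q′ * r + 3 * (p * s′ + 1)
      ≡⟨ solve (q′ ∷ s′ ∷ p ∷ r ∷ []) ⟩
    (2 * p + r) * (q′ + 2 * s′) + 3 ≡⟨ cong (λ x → x * (q′ + 2 * s′) + 3) 2p+r≡3w ⟩
    3 * w * (q′ + 2 * s′) + 3      ≡⟨ solve (w ∷ q′ ∷ s′ ∷ []) ⟩
    3 * (w * (q′ + 2 * s′) + 1)    ∎)

2[3mq]+3ms≡3[m[2q+s]] : ∀ m q s → 2 * (3 * m * q) + 3 * m * s ≡ 3 * (m * (2 * q + s))
2[3mq]+3ms≡3[m[2q+s]] = solve-∀

3mq+2[3ms]≡3[m[q+2s]] : ∀ m q s → 3 * m * q + 2 * (3 * m * s) ≡ 3 * (m * (q + 2 * s))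
3mq+2[3ms]≡3[m[q+2s]] = solve-∀

adjacent-children : ∀ {m} x y → Adjacent (3 * m) (x , y) →
  Adjacent m (x , left x y) × Adjacent m (left x y , right x y) × Adjacent m (right x y , y)
adjacent-children {m} (p , _) (r , _) adj@(adjacent q′ s′ refl refl det≡ p≡r) =
  subst (λ z → Adjacent m ((p , 3 * m * q′) , z)) (sym left≡)
    (adjacent (3 * q′) Y (solve (m ∷ q′ ∷ [])) refl (det-left w 2p+r≡3w) p≡w) ,
  subst₂ (λ z₁ z₂ → Adjacent m (z₁ , z₂)) (sym left≡) (sym right≡)
    (adjacent Y Z refl refl det-middle′ w≡v) ,
  subst (λ z → Adjacent m (z , (r , 3 * m * s′))) (sym right≡)
    (adjacent Z (3 * s′) refl (solve (m ∷ s′ ∷ [])) (det-right v p+2r≡3v) v≡r)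
  where
  open Trisection (trisect {m} p≡r)
  open ChildDeterminants {p} {q′} {r} {s′} det≡
  Y Z : ℕ
  Y = 2 * q′ + s′
  Z = q′ + 2 * s′
  det-middle′ : Y * v ≡ w * Z + 1
  det-middle′ = det-middle w v 2p+r≡3w p+2r≡3v
  w⊥m : Coprime w m
  w⊥m = coprime-resp-mod p≡w λ (d∣p , d∣m) → adjacent⇒coprime adj (d∣p , ∣n⇒∣m*n 3 d∣m)
  w⊥mY : Coprime w (m * Y)
  w⊥mY = coprime-* w⊥m (unit-det⇒coprime (3 * q′) p (det-left w 2p+r≡3w))
  v⊥mZ : Coprime v (m * Z)
  v⊥mZ = coprime-* (coprime-resp-mod w≡v w⊥m) (unit-det⇒coprime Y w det-middle′)
  left≡ : left (p , 3 * m * q′) (r , 3 * m * s′) ≡ (w , m * Y)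
  left≡ = begin
    reduce (2 * p + r) (2 * (3 * m * q′) + 3 * m * s′)
      ≡⟨ cong₂ reduce 2p+r≡3w (2[3mq]+3ms≡3[m[2q+s]] m q′ s′) ⟩
    reduce (3 * w) (3 * (m * Y)) ≡⟨ reduce-scaled 2 w⊥mY ⟩
    (w , m * Y)                  ∎
  right≡ : right (p , 3 * m * q′) (r , 3 * m * s′) ≡ (v , m * Z)
  right≡ = begin
    reduce (p + 2 * r) (3 * m * q′ + 2 * (3 * m * s′))
      ≡⟨ cong₂ reduce p+2r≡3v (3mq+2[3ms]≡3[m[q+2s]] m q′ s′) ⟩
    reduce (3 * v) (3 * (m * Z)) ≡⟨ reduce-scaled 2 v⊥mZ ⟩
    (v , m * Z)                  ∎

child : ℕ → Frac × Frac → Frac × Frac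
child zero          (x , y) = x , left x y
child (suc zero)    (x , y) = left x y , right x y
child (suc (suc _)) (x , y) = right x y , y

adjacent-child : ∀ {m} c {xy} → Adjacent (3 * m) xy → Adjacent m (child c xy)
adjacent-child zero          {x , y} adj = proj₁ (adjacent-children x y adj)
adjacent-child (suc zero)    {x , y} adj = proj₁ (proj₂ (adjacent-children x y adj))
adjacent-child (suc (suc _)) {x , y} adj = proj₂ (proj₂ (adjacent-children x y adj))

n⊥2n+1 : ∀ n → Coprime n (2 * n + 1)
n⊥2n+1 n = coprime-sym (unit-det⇒coprime 1 2 (*-identityˡ (2 * n + 1)))

1+n⊥2n+1 : ∀ n → Coprime (suc n) (2 * n + 1)
1+n⊥2n+1 n = unit-det⇒coprime 2 1 (2[1+n]≡[2n+1]+1 n)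
  where
  2[1+n]≡[2n+1]+1 : ∀ n → 2 * suc n ≡ 1 * (2 * n + 1) + 1
  2[1+n]≡[2n+1]+1 = solve-∀

central : ℕ → Frac × Frac
central a = (a , 2 * a + 1) , (suc a , 2 * a + 1)

left-central : ∀ a → left (a , 2 * a + 1) (suc a , 2 * a + 1) ≡ (3 * a + 1 , 2 * (3 * a + 1) + 1)
left-central a = begin
  reduce (2 * a + suc a) (2 * (2 * a + 1) + (2 * a + 1))
    ≡⟨ cong₂ reduce (solve (a ∷ [])) (solve (a ∷ [])) ⟩
  reduce (3 * a + 1) (2 * (3 * a + 1) + 1)               ≡⟨ reduce-coprime (n⊥2n+1 (3 * a + 1)) ⟩
  (3 * a + 1 , 2 * (3 * a + 1) + 1)                     ∎

right-central : ∀ a → right (a , 2 * a + 1) (suc a , 2 * a + 1) ≡ (suc (3 * a + 1) , 2 * (3 * a + 1) + 1)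
right-central a = begin
  reduce (a + 2 * suc a) (2 * a + 1 + 2 * (2 * a + 1))
    ≡⟨ cong₂ reduce (solve (a ∷ [])) (solve (a ∷ [])) ⟩
  reduce (suc (3 * a + 1)) (2 * (3 * a + 1) + 1)       ≡⟨ reduce-coprime (1+n⊥2n+1 (3 * a + 1)) ⟩
  (suc (3 * a + 1) , 2 * (3 * a + 1) + 1)              ∎

child-central : ∀ a → child 1 (central a) ≡ central (3 * a + 1)
child-central a = cong₂ _,_ (left-central a) (right-central a)

adjacent-child-central : ∀ {c} a → c ≡ 0 ⊎ c ≡ 2 → Adjacent (2 * a + 1) (child c (central a))
adjacent-child-central a (inj₁ refl) rewrite left-central a =
  adjacent 1 3 (sym (*-identityʳ _)) (solve (a ∷ [])) (solve (a ∷ [])) (below 1 (solve (a ∷ [])))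
adjacent-child-central a (inj₂ refl) rewrite right-central a =
  adjacent 3 1 (solve (a ∷ [])) (sym (*-identityʳ _)) (solve (a ∷ [])) (above 1 (solve (a ∷ [])))

centre : ℕ → ℕ
centre zero    = 0
centre (suc L) = 3 * centre L + 1

2*centre+1≡3^ : ∀ L → 2 * centre L + 1 ≡ 3 ^ L
2*centre+1≡3^ zero    = refl
2*centre+1≡3^ (suc L) = begin
  2 * (3 * centre L + 1) + 1 ≡⟨ 2[3a+1]+1≡3[2a+1] (centre L) ⟩
  3 * (2 * centre L + 1)     ≡⟨ cong (3 *_) (2*centre+1≡3^ L) ⟩
  3 * 3 ^ L                  ∎
  where
  2[3a+1]+1≡3[2a+1] : ∀ a → 2 * (3 * a + 1) + 1 ≡ 3 * (2 * a + 1)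
  2[3a+1]+1≡3[2a+1] = solve-∀

pairAt : List Frac → ℕ → Frac × Frac
pairAt xs i = nth xs i , nth xs (suc i)

interval : ℕ → ℕ → Frac × Frac
interval zero    i = (0 , 1) , (1 , 1)
interval (suc n) i = child (i % 3) (interval n (i / 3))

head-step : ∀ x xs → nth (step (x ∷ xs)) 0 ≡ x
head-step x []      = refl
head-step x (_ ∷ _) = refl

pairAt-step : ∀ xs j c → suc j < length xs → c < 3 →
  pairAt (step xs) (c + 3 * j) ≡ child c (pairAt xs j)
pairAt-step (x ∷ y ∷ xs) zero    0 _ _ = refl
pairAt-step (x ∷ y ∷ xs) zero    1 _ _ = refl
pairAt-step (x ∷ y ∷ xs) zero    2 _ _ = cong (right x y ,_) (head-step y xs)
pairAt-step (x ∷ y ∷ xs) zero    (suc (suc (suc _))) _ (s≤s (s≤s (s≤s ())))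
pairAt-step (_ ∷ [])     _       _ (s≤s ()) _
pairAt-step (x ∷ y ∷ xs) (suc j) c (s≤s j<) c<3 =
  subst (λ i → pairAt (step (x ∷ y ∷ xs)) i ≡ child c (pairAt (y ∷ xs) j))
    (sym (c+3[1+j]≡3+[c+3j] c j)) (pairAt-step (y ∷ xs) j c j< c<3)
  where
  c+3[1+j]≡3+[c+3j] : ∀ c j → c + 3 * suc j ≡ 3 + (c + 3 * j)
  c+3[1+j]≡3+[c+3j] = solve-∀

length-step : ∀ x xs → length (step (x ∷ xs)) ≡ suc (3 * length xs)
length-step x []       = refl
length-step x (y ∷ xs) = begin
  3 + length (step (y ∷ xs)) ≡⟨ cong (λ k → 3 + k) (length-step y xs) ⟩
  3 + suc (3 * length xs)    ≡⟨ 3+[1+3k]≡1+3[1+k] (length xs) ⟩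
  suc (3 * suc (length xs))  ∎
  where
  3+[1+3k]≡1+3[1+k] : ∀ k → 3 + suc (3 * k) ≡ suc (3 * suc k)
  3+[1+3k]≡1+3[1+k] = solve-∀

length-SB : ∀ n → length (SB n) ≡ suc (3 ^ n)
length-SB zero    = refl
length-SB (suc n) with SB n | length-SB n
... | []     | ()
... | x ∷ xs | len≡ = trans (length-step x xs) (cong (λ k → suc (3 * k)) (suc-injective len≡))

pairAt-SB : ∀ n i → i < 3 ^ n → pairAt (SB n) i ≡ interval n i
pairAt-SB zero    zero    _        = refl
pairAt-SB zero    (suc _) (s≤s ())
pairAt-SB (suc n) i       i<3^1+n  = begin
  pairAt (step (SB n)) i                     ≡⟨ cong (pairAt (step (SB n))) i≡ ⟩
  pairAt (step (SB n)) (i % 3 + 3 * (i / 3)) ≡⟨ pairAt-step (SB n) (i / 3) (i % 3) 1+i/3<len (m%n<n i 3) ⟩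
  child (i % 3) (pairAt (SB n) (i / 3))      ≡⟨ cong (child (i % 3)) (pairAt-SB n (i / 3) i/3<3^n) ⟩
  interval (suc n) i                         ∎
  where
  i≡ : i ≡ i % 3 + 3 * (i / 3)
  i≡ = trans (m≡m%n+[m/n]*n i 3) (cong (λ k → i % 3 + k) (*-comm (i / 3) 3))
  i/3<3^n : i / 3 < 3 ^ n
  i/3<3^n = m<n*o⇒m/o<n (subst (i <_) (*-comm 3 (3 ^ n)) i<3^1+n)
  1+i/3<len : suc (i / 3) < length (SB n)
  1+i/3<len = subst (suc (i / 3) <_) (sym (length-SB n)) (s≤s i/3<3^n)

ancestor : ℕ → ℕ → ℕ → Frac × Frac
ancestor n i L = interval L (div3pow (n ∸ L) i)

ancestor-suc : ∀ {n i L} → suc L ≤ n →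
  ancestor n i (suc L) ≡ child (digit n i (suc L)) (ancestor n i L)
ancestor-suc {n} {i} {L} L<n =
  cong (λ e → child (digit n i (suc L)) (interval L (div3pow e i))) (sym (+-∸-assoc 1 L<n))

ancestor-top : ∀ n i → ancestor n i n ≡ interval n i
ancestor-top n i = cong (λ e → interval n (div3pow e i)) (n∸n≡0 n)

ancestor-central : ∀ {n i} L → L ≤ n → (∀ t → 1 ≤ t → t < suc L → digit n i t ≡ 1) →
  ancestor n i L ≡ central (centre L)
ancestor-central zero _ _ = refl
ancestor-central {n} {i} (suc L) L<n ones = begin
  ancestor n i (suc L)                       ≡⟨ ancestor-suc L<n ⟩
  child (digit n i (suc L)) (ancestor n i L)
    ≡⟨ cong₂ child (ones (suc L) (s≤s z≤n) ≤-refl) ancestor≡ ⟩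
  child 1 (central (centre L))               ≡⟨ child-central (centre L) ⟩
  central (centre (suc L))                   ∎
  where
  ancestor≡ : ancestor n i L ≡ central (centre L)
  ancestor≡ = ancestor-central L (<⇒≤ L<n) (λ t 1≤t t<1+L → ones t 1≤t (m<n⇒m<1+n t<1+L))

descend : ∀ {n i} e L → L + e ≡ n → Adjacent (3 ^ e) (ancestor n i L) → Adjacent 1 (ancestor n i n)
descend {n} {i} zero    L L+0≡n adj =
  subst (λ l → Adjacent 1 (ancestor n i l)) (trans (sym (+-identityʳ L)) L+0≡n) adj
descend {n} {i} (suc e) L L+1+e≡n adj =
  descend e (suc L) 1+L+e≡n
    (subst (Adjacent (3 ^ e)) (sym (ancestor-suc 1+L≤n)) (adjacent-child (digit n i (suc L)) adj))
  where
  1+L+e≡n : suc L + e ≡ n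
  1+L+e≡n = trans (sym (+-suc L e)) L+1+e≡n
  1+L≤n : suc L ≤ n
  1+L≤n = subst (suc L ≤_) 1+L+e≡n (m≤m+n (suc L) e)

C-middle : ∀ j i → i < 3 ^ suc (j + j) → Middleness (suc (j + j)) i (suc j) → C (suc (j + j)) i ≡ + 1
C-middle j i i<3^n (_ , _ , dₖ≡0∨2 , ones) = det-adjacent adjₙ
  where
  n : ℕ
  n = suc (j + j)
  ancestorₖ≡ : ancestor n i (suc j) ≡ child (digit n i (suc j)) (central (centre j))
  ancestorₖ≡ = trans (ancestor-suc (s≤s (m≤m+n j j)))
    (cong (child _) (ancestor-central j (≤-trans (m≤m+n j j) (n≤1+n _)) ones))
  adjₖ : Adjacent (3 ^ j) (ancestor n i (suc j))
  adjₖ = subst₂ Adjacent (2*centre+1≡3^ j) (sym ancestorₖ≡)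
    (adjacent-child-central (centre j) dₖ≡0∨2)
  adjₙ : Adjacent 1 (pairAt (SB n) i)
  adjₙ = subst (Adjacent 1) (trans (ancestor-top n i) (sym (pairAt-SB n i i<3^n)))
    (descend j (suc j) refl adjₖ)

2[1+j]∸1≡1+2j : ∀ j → 2 * suc j ∸ 1 ≡ suc (j + j)
2[1+j]∸1≡1+2j j = trans (+-suc j (j + 0)) (cong (λ k → suc (j + k)) (+-identityʳ j))

corollary20 : (k : ℕ) → 1 ≤ k → (i : ℕ) → i < 3 ^ (2 * k ∸ 1) →
    Middleness (2 * k ∸ 1) i k → C (2 * k ∸ 1) i ≡ + 1
corollary20 zero    ()
corollary20 (suc j) _ i =
  subst (λ n → i < 3 ^ n → Middleness n i (suc j) → C n i ≡ + 1) (sym (2[1+j]∸1≡1+2j j))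
    (C-middle j i)
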